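{- Let $M=(E,r)$ be an arbitrary matroid on a finite set $E$ with rank function $r$. Then, as identities of rational functions in the variable $q$, $$\chi_{M^\perp}(q)=(q-1)^{|E|}\sum_{A\subseteq E}\Big(\frac{q}{1-q}\Big)^{|A|}\frac{\chi_{M|_A}(q)}{q^{r(A)}},$$ $$\chi_{M^\perp}(q)=q^{ -r(E)}\sum_{A\subseteq E}(-1)^{|E|-|A|}(q-1)^{|A|}\chi_{M/A}(q).$$
   Context: For a matroid $N$ on ground set $S$ with rank function $r_N$, the characteristic polynomial is $\chi_N(x)=\sum_{X\subseteq S}(-1)^{|X|}x^{r_N(S)-r_N(X)}$. $M^\perp$ is the dual matroid on $E$ with rank function $r^\perp(A)=|A|-r(E)+r(E\setminus A)$. $M|_A$ is the restriction of $M$ to $A$ (ground set $A$, rank function $r$ restricted to subsets of $A$), and $M/A$ is the contraction of $A$ (ground set $E\setminus A$, rank function $X\mapsto r(X\cup A)-r(A)$). -}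

module Defs where

open import Data.Nat as ℕ using (ℕ; zero; suc; _∸_) renaming (_+_ to _+ℕ_; _≤_ to _≤ℕ_)
open import Data.Vec using ([]; _∷_)
open import Data.List using (List; []; _∷_; map; _++_; foldr)
open import Data.Fin.Subset using (Subset; inside; outside; _⊆_; _∪_; _∩_; ∣_∣; ∁; ⊤)
open import Data.Rational using (ℚ; 0ℚ; 1ℚ; _+_; _*_; -_; _-_; 1/_; ≢-nonZero)
open import Relation.Binary.PropositionalEquality using (_≢_)

record Matroid (n : ℕ) : Set where
  field
    rank       : Subset n → ℕ
    rank-card  : ∀ X → rank X ≤ℕ ∣ X ∣
    rank-mono  : ∀ {X Y} → X ⊆ Y → rank X ≤ℕ rank Y
    rank-submod : ∀ X Y → rank (X ∪ Y) +ℕ rank (X ∩ Y) ≤ℕ rank X +ℕ rank Y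
open Matroid public

subsetsOf : ∀ {n} → Subset n → List (Subset n)
subsetsOf [] = [] ∷ []
subsetsOf (outside ∷ s) = map (outside ∷_) (subsetsOf s)
subsetsOf (inside ∷ s) = map (outside ∷_) (subsetsOf s) ++ map (inside ∷_) (subsetsOf s)

sumℚ : List ℚ → ℚ
sumℚ = foldr _+_ 0ℚ

Σ⊆ : ∀ {n} → Subset n → (Subset n → ℚ) → ℚ
Σ⊆ S f = sumℚ (map f (subsetsOf S))

_^_ : ℚ → ℕ → ℚ
q ^ zero = 1ℚ
q ^ suc k = q * (q ^ k)

-1ℚ : ℚ
-1ℚ = - 1ℚ

inv : (q : ℚ) → q ≢ 0ℚ → ℚ
inv q q≢0 = 1/_ q {{≢-nonZero q≢0}}

-- Characteristic polynomial of a matroid with ground set S ⊆ Fin n and rank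
-- function rk (only its values on subsets of S matter), evaluated at x:
--   χ(x) = Σ_{X ⊆ S} (-1)^{|X|} x^{rk(S) - rk(X)}
χ : ∀ {n} → (S : Subset n) → (rk : Subset n → ℕ) → ℚ → ℚ
χ S rk x = Σ⊆ S (λ X → (-1ℚ ^ ∣ X ∣) * (x ^ (rk S ∸ rk X)))

dualRank : ∀ {n} → Matroid n → Subset n → ℕ
dualRank M A = (∣ A ∣ +ℕ rank M (∁ A)) ∸ rank M ⊤

χDual : ∀ {n} → Matroid n → ℚ → ℚ
χDual M = χ ⊤ (dualRank M)

χRestr : ∀ {n} → Matroid n → Subset n → ℚ → ℚ
χRestr M A = χ A (rank M)

χContr : ∀ {n} → Matroid n → Subset n → ℚ → ℚ
χContr M A = χ (∁ A) (λ X → rank M (X ∪ A) ∸ rank M A)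

-- Each side equals Σ_{X ⊆ E} (-1)^{|E \ X|} q^{|X| - r(X)}.  For χ_{M⊥} this is the
-- substitution X ↦ E \ X, because r⊥(E) - r⊥(E \ X) = |X| - r(X).  In the restriction
-- formula, exchanging the sums over A and X ⊆ A attaches to X the weight
-- t^{|X|} (1 + t)^{|E \ X|} of its supersets, and for t = q/(1 - q) one has
-- (q - 1) t = -q and (q - 1)(1 + t) = -1.  In the contraction formula, a pair A, X ⊆ E \ A
-- is a set B = X ∪ A split into two parts, and summing over the splits of B gives
-- ((q - 1) + 1)^{|B|} = q^{|B|}.
module Submission where

open import Defs
open import Data.Nat using (ℕ; zero; suc; _∸_) renaming (_+_ to _+ℕ_; _≤_ to _≤ℕ_)
import Data.Nat.Properties as ℕ
open import Data.Product using (_×_; _,_)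
open import Data.Bool.Properties using (not-involutive)
open import Data.Vec using ([]; _∷_)
import Data.Vec.Properties as Vec
open import Data.List using ([]; _∷_; map; _++_)
import Data.List.Properties as List
open import Data.Fin.Subset using (Subset; inside; outside; _⊆_; _∪_; _∩_; ∁; ⊤; ∣_∣)
open import Data.Fin.Subset.Properties
  using (out⊆; in⊆in; ∣p∣≤n; p∪∁p≡⊤; ∣∁p∣≡n∸∣p∣; ∣⊤∣≡n; ∪-comm; q⊆p∪q; ⊆⊤)
open import Data.Rational using (ℚ; 0ℚ; 1ℚ; _+_; _*_; -_; _-_; ≢-nonZero)
open import Data.Rational.Properties
  using (+-identityˡ; +-assoc; +-comm; *-comm; *-assoc; *-zeroʳ; *-distribˡ-+; *-inverseˡ; +-*-commutativeRing)
open import Data.Rational.Solver using (module +-*-Solver)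
open import Algebra.Bundles using (CommutativeRing)
import Algebra.Properties.CommutativeSemiring.Exp (CommutativeRing.commutativeSemiring +-*-commutativeRing) as Exp
open import Function using (_∘_)
open import Relation.Binary.PropositionalEquality

open +-*-Solver

∁-involutive : ∀ {n} (X : Subset n) → ∁ (∁ X) ≡ X
∁-involutive X = trans (sym (Vec.map-∘ _ _ X)) (trans (Vec.map-cong not-involutive X) (Vec.map-id X))

sumℚ-++ : ∀ xs ys → sumℚ (xs ++ ys) ≡ sumℚ xs + sumℚ ys
sumℚ-++ []       ys = sym (+-identityˡ _)
sumℚ-++ (x ∷ xs) ys = trans (cong (x +_) (sumℚ-++ xs ys)) (sym (+-assoc x _ _))

sumℚ-map-∘ : ∀ {A B : Set} (f : B → ℚ) (g : A → B) xs →
             sumℚ (map f (map g xs)) ≡ sumℚ (map (f ∘ g) xs)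
sumℚ-map-∘ f g xs = cong sumℚ (sym (List.map-∘ xs))

*-distribˡ-sumℚ : ∀ {A : Set} c (f : A → ℚ) xs →
                  c * sumℚ (map f xs) ≡ sumℚ (map (λ x → c * f x) xs)
*-distribˡ-sumℚ c f []       = *-zeroʳ c
*-distribˡ-sumℚ c f (x ∷ xs) = trans (*-distribˡ-+ c (f x) _) (cong (c * f x +_) (*-distribˡ-sumℚ c f xs))

sumℚ-linear : ∀ {A : Set} a b (f g : A → ℚ) xs →
              sumℚ (map (λ x → a * f x + b * g x) xs) ≡ a * sumℚ (map f xs) + b * sumℚ (map g xs)
sumℚ-linear a b f g [] = solve 2 (λ a b → con 0ℚ := a :* con 0ℚ :+ b :* con 0ℚ) refl a b
sumℚ-linear a b f g (x ∷ xs) = trans (cong (a * f x + b * g x +_) (sumℚ-linear a b f g xs))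
  (solve 6 (λ a b u v s t → (a :* u :+ b :* v) :+ (a :* s :+ b :* t) := a :* (u :+ s) :+ b :* (v :+ t))
         refl a b (f x) (g x) (sumℚ (map f xs)) (sumℚ (map g xs)))

module _ {n : ℕ} where

  Σ⊆-outside : ∀ (S : Subset n) f → Σ⊆ (outside ∷ S) f ≡ Σ⊆ S (f ∘ (outside ∷_))
  Σ⊆-outside S f = sumℚ-map-∘ f _ (subsetsOf S)

  Σ⊆-inside : ∀ (S : Subset n) f →
              Σ⊆ (inside ∷ S) f ≡ Σ⊆ S (f ∘ (outside ∷_)) + Σ⊆ S (f ∘ (inside ∷_))
  Σ⊆-inside S f = begin
      sumℚ (map f (map (outside ∷_) Xs ++ map (inside ∷_) Xs))
    ≡⟨ cong sumℚ (List.map-++ f (map (outside ∷_) Xs) _) ⟩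
      sumℚ (map f (map (outside ∷_) Xs) ++ map f (map (inside ∷_) Xs))
    ≡⟨ sumℚ-++ (map f (map (outside ∷_) Xs)) _ ⟩
      sumℚ (map f (map (outside ∷_) Xs)) + sumℚ (map f (map (inside ∷_) Xs))
    ≡⟨ cong₂ _+_ (sumℚ-map-∘ f _ Xs) (sumℚ-map-∘ f _ Xs) ⟩
      Σ⊆ S (f ∘ (outside ∷_)) + Σ⊆ S (f ∘ (inside ∷_))
    ∎
    where
    open ≡-Reasoning
    Xs = subsetsOf S

  *-distribˡ-Σ⊆ : ∀ (S : Subset n) c f → c * Σ⊆ S f ≡ Σ⊆ S (λ X → c * f X)
  *-distribˡ-Σ⊆ S c f = *-distribˡ-sumℚ c f (subsetsOf S)

  Σ⊆-linear : ∀ (S : Subset n) a b f g →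
              Σ⊆ S (λ X → a * f X + b * g X) ≡ a * Σ⊆ S f + b * Σ⊆ S g
  Σ⊆-linear S a b f g = sumℚ-linear a b f g (subsetsOf S)

Σ⊆-cong : ∀ {n} (S : Subset n) {f g} → (∀ X → X ⊆ S → f X ≡ g X) → Σ⊆ S f ≡ Σ⊆ S g
Σ⊆-cong []            f≗g = cong (_+ 0ℚ) (f≗g [] (λ ()))
Σ⊆-cong (outside ∷ S) {f} {g} f≗g =
  trans (Σ⊆-outside S f) (trans (Σ⊆-cong S (λ X X⊆S → f≗g _ (out⊆ X⊆S))) (sym (Σ⊆-outside S g)))
Σ⊆-cong (inside ∷ S)  {f} {g} f≗g =
  trans (Σ⊆-inside S f)
    (trans (cong₂ _+_ (Σ⊆-cong S (λ X X⊆S → f≗g _ (out⊆ X⊆S))) (Σ⊆-cong S (λ X X⊆S → f≗g _ (in⊆in X⊆S))))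
      (sym (Σ⊆-inside S g)))

Σ⊆-cong′ : ∀ {n} (S : Subset n) {f g} → (∀ X → f X ≡ g X) → Σ⊆ S f ≡ Σ⊆ S g
Σ⊆-cong′ S f≗g = Σ⊆-cong S (λ X _ → f≗g X)

Σ⊆-⊤-suc : ∀ {n} (f : Subset (suc n) → ℚ) {g₀ g₁ : Subset n → ℚ} →
           (∀ X → f (outside ∷ X) ≡ g₀ X) → (∀ X → f (inside ∷ X) ≡ g₁ X) →
           Σ⊆ ⊤ f ≡ Σ⊆ ⊤ g₀ + Σ⊆ ⊤ g₁
Σ⊆-⊤-suc f f₀≗g₀ f₁≗g₁ = trans (Σ⊆-inside ⊤ f) (cong₂ _+_ (Σ⊆-cong′ ⊤ f₀≗g₀) (Σ⊆-cong′ ⊤ f₁≗g₁))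

Σ⊆-⊤-∁ : ∀ n (f : Subset n → ℚ) → Σ⊆ ⊤ (f ∘ ∁) ≡ Σ⊆ ⊤ f
Σ⊆-⊤-∁ zero    f = refl
Σ⊆-⊤-∁ (suc n) f = begin
    Σ⊆ ⊤ (f ∘ ∁)
  ≡⟨ Σ⊆-inside ⊤ (f ∘ ∁) ⟩
    Σ⊆ ⊤ ((f ∘ (inside ∷_)) ∘ ∁) + Σ⊆ ⊤ ((f ∘ (outside ∷_)) ∘ ∁)
  ≡⟨ cong₂ _+_ (Σ⊆-⊤-∁ n (f ∘ (inside ∷_))) (Σ⊆-⊤-∁ n (f ∘ (outside ∷_))) ⟩
    Σ⊆ ⊤ (f ∘ (inside ∷_)) + Σ⊆ ⊤ (f ∘ (outside ∷_))
  ≡⟨ +-comm (Σ⊆ ⊤ (f ∘ (inside ∷_))) _ ⟩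
    Σ⊆ ⊤ (f ∘ (outside ∷_)) + Σ⊆ ⊤ (f ∘ (inside ∷_))
  ≡⟨ Σ⊆-inside ⊤ f ⟨
    Σ⊆ ⊤ f
  ∎
  where open ≡-Reasoning

[m∸o]∸[n∸o]≡m∸n : ∀ m {n o} → o ≤ℕ n → (m ∸ o) ∸ (n ∸ o) ≡ m ∸ n
[m∸o]∸[n∸o]≡m∸n m {n} {o} o≤n = trans (ℕ.∸-+-assoc m o (n ∸ o)) (cong (m ∸_) (ℕ.m+[n∸m]≡n o≤n))

^≗Exp^ : ∀ x n → x ^ n ≡ x Exp.^ n
^≗Exp^ x zero    = refl
^≗Exp^ x (suc n) = cong (x *_) (^≗Exp^ x n)

^-homo-* : ∀ x m n → x ^ (m +ℕ n) ≡ x ^ m * x ^ n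
^-homo-* x m n rewrite ^≗Exp^ x (m +ℕ n) | ^≗Exp^ x m | ^≗Exp^ x n = Exp.^-homo-* x m n

^-distrib-* : ∀ x y n → (x * y) ^ n ≡ x ^ n * y ^ n
^-distrib-* x y n rewrite ^≗Exp^ (x * y) n | ^≗Exp^ x n | ^≗Exp^ y n = Exp.^-distrib-* x y n

module _ {x y : ℚ} (x*y≡1 : x * y ≡ 1ℚ) where

  ^-inverse : ∀ n → x ^ n * y ^ n ≡ 1ℚ
  ^-inverse zero    = solve 0 (con 1ℚ :* con 1ℚ := con 1ℚ) refl
  ^-inverse (suc n) =
    trans (solve 4 (λ x y u v → (x :* u) :* (y :* v) := (x :* y) :* (u :* v)) refl x y (x ^ n) (y ^ n))
      (trans (cong₂ _*_ x*y≡1 (^-inverse n)) (solve 0 (con 1ℚ :* con 1ℚ := con 1ℚ) refl))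

  ^-∸-inverseʳ : ∀ {m n} → m ≤ℕ n → x ^ n * y ^ m ≡ x ^ (n ∸ m)
  ^-∸-inverseʳ {m} {n} m≤n = begin
      x ^ n * y ^ m
    ≡⟨ cong (λ k → x ^ k * y ^ m) (ℕ.m+[n∸m]≡n m≤n) ⟨
      x ^ (m +ℕ d) * y ^ m
    ≡⟨ cong (_* y ^ m) (^-homo-* x m d) ⟩
      x ^ m * x ^ d * y ^ m
    ≡⟨ solve 3 (λ u v w → u :* v :* w := (u :* w) :* v) refl (x ^ m) (x ^ d) (y ^ m) ⟩
      (x ^ m * y ^ m) * x ^ d
    ≡⟨ cong (_* x ^ d) (^-inverse m) ⟩
      1ℚ * x ^ d
    ≡⟨ solve 1 (λ u → con 1ℚ :* u := u) refl (x ^ d) ⟩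
      x ^ d
    ∎
    where
    open ≡-Reasoning
    d = n ∸ m

  ^-∸-inverseˡ : ∀ {m n} → m ≤ℕ n → x ^ (n ∸ m) * y ^ n ≡ y ^ m
  ^-∸-inverseˡ {m} {n} m≤n = begin
      x ^ d * y ^ n
    ≡⟨ cong (λ k → x ^ d * y ^ k) (ℕ.m+[n∸m]≡n m≤n) ⟨
      x ^ d * y ^ (m +ℕ d)
    ≡⟨ cong (x ^ d *_) (^-homo-* y m d) ⟩
      x ^ d * (y ^ m * y ^ d)
    ≡⟨ solve 3 (λ u v w → u :* (v :* w) := (u :* w) :* v) refl (x ^ d) (y ^ m) (y ^ d) ⟩
      (x ^ d * y ^ d) * y ^ m
    ≡⟨ cong (_* y ^ m) (^-inverse d) ⟩
      1ℚ * y ^ m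
    ≡⟨ solve 1 (λ u → con 1ℚ :* u := u) refl (y ^ m) ⟩
      y ^ m
    ∎
    where
    open ≡-Reasoning
    d = n ∸ m

*-inv≡1 : ∀ q (q≢0 : q ≢ 0ℚ) → q * inv q q≢0 ≡ 1ℚ
*-inv≡1 q q≢0 = trans (*-comm q _) (*-inverseˡ q {{≢-nonZero q≢0}})

module _ (q u : ℚ) (u*[1-q]≡1 : u * (1ℚ - q) ≡ 1ℚ) where

  q*u*[q-1]≡-q : (q * u) * (q - 1ℚ) ≡ - q
  q*u*[q-1]≡-q = trans
    (solve 2 (λ q u → (q :* u) :* (q :- con 1ℚ) := (:- q) :* (u :* (con 1ℚ :- q))) refl q u)
    (trans (cong ((- q) *_) u*[1-q]≡1) (solve 1 (λ q → (:- q) :* con 1ℚ := :- q) refl q))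

  [1+q*u]*[q-1]≡-1 : (1ℚ + q * u) * (q - 1ℚ) ≡ -1ℚ
  [1+q*u]*[q-1]≡-1 = trans
    (solve 2 (λ q u → (con 1ℚ :+ q :* u) :* (q :- con 1ℚ) := (q :- con 1ℚ) :+ (:- q) :* (u :* (con 1ℚ :- q))) refl q u)
    (trans (cong (λ z → (q - 1ℚ) + (- q) * z) u*[1-q]≡1) (solve 1 (λ q → (q :- con 1ℚ) :+ (:- q) :* con 1ℚ := con -1ℚ) refl q))

binomialWeight : ∀ {n} → ℚ → ℚ → Subset n → ℚ
binomialWeight {n} x y X = (x ^ ∣ X ∣) * (y ^ (n ∸ ∣ X ∣))

binomialSum : ∀ {n} → ℚ → ℚ → (Subset n → ℚ) → ℚ
binomialSum x y g = Σ⊆ ⊤ (λ X → g X * binomialWeight x y X)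

module _ {n : ℕ} (x y : ℚ) (X : Subset n) where

  binomialWeight-outside : binomialWeight x y (outside ∷ X) ≡ y * binomialWeight x y X
  binomialWeight-outside = trans (cong (λ k → (x ^ ∣ X ∣) * (y ^ k)) (ℕ.+-∸-assoc 1 (∣p∣≤n X)))
    (solve 3 (λ y u v → u :* (y :* v) := y :* (u :* v)) refl y (x ^ ∣ X ∣) (y ^ (n ∸ ∣ X ∣)))

  binomialWeight-inside : binomialWeight x y (inside ∷ X) ≡ x * binomialWeight x y X
  binomialWeight-inside = *-assoc x (x ^ ∣ X ∣) (y ^ (n ∸ ∣ X ∣))

^-*-binomialWeight : ∀ {n} z x y (X : Subset n) →
                     z ^ n * binomialWeight x y X ≡ binomialWeight (x * z) (y * z) X
^-*-binomialWeight {n} z x y X = begin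
    z ^ n * (x ^ k * y ^ m)
  ≡⟨ cong (λ e → z ^ e * (x ^ k * y ^ m)) (ℕ.m+[n∸m]≡n (∣p∣≤n X)) ⟨
    z ^ (k +ℕ m) * (x ^ k * y ^ m)
  ≡⟨ cong (_* (x ^ k * y ^ m)) (^-homo-* z k m) ⟩
    (z ^ k * z ^ m) * (x ^ k * y ^ m)
  ≡⟨ solve 4 (λ a b u v → (a :* b) :* (u :* v) := (u :* a) :* (v :* b)) refl (z ^ k) (z ^ m) (x ^ k) (y ^ m) ⟩
    (x ^ k * z ^ k) * (y ^ m * z ^ m)
  ≡⟨ cong₂ _*_ (^-distrib-* x z k) (^-distrib-* y z m) ⟨
    (x * z) ^ k * (y * z) ^ m
  ∎
  where
  open ≡-Reasoning
  k = ∣ X ∣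
  m = n ∸ k

binomialSum-suc : ∀ {n} x y (g : Subset (suc n) → ℚ) →
  binomialSum x y g ≡ y * binomialSum x y (g ∘ (outside ∷_)) + x * binomialSum x y (g ∘ (inside ∷_))
binomialSum-suc {n} x y g = trans
  (Σ⊆-⊤-suc (λ X → g X * binomialWeight x y X)
             (scaled y (outside ∷_) (binomialWeight-outside x y))
             (scaled x (inside ∷_) (binomialWeight-inside x y)))
  (sym (cong₂ _+_ (*-distribˡ-Σ⊆ ⊤ y (λ X → g (outside ∷ X) * binomialWeight x y X))
                  (*-distribˡ-Σ⊆ ⊤ x (λ X → g (inside ∷ X) * binomialWeight x y X))))
  where
  scaled : ∀ c (h : Subset n → Subset (suc n)) →
           (∀ X → binomialWeight x y (h X) ≡ c * binomialWeight x y X) →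
           ∀ X → g (h X) * binomialWeight x y (h X) ≡ c * (g (h X) * binomialWeight x y X)
  scaled c h w X = trans (cong (g (h X) *_) (w X))
    (solve 3 (λ c u v → u :* (c :* v) := c :* (u :* v)) refl c (g (h X)) (binomialWeight x y X))

Σ⊆-supersets-suc : ∀ {n} t (g : Subset (suc n) → ℚ) →
  Σ⊆ ⊤ (λ A → (t ^ ∣ A ∣) * Σ⊆ A g)
    ≡ (1ℚ + t) * Σ⊆ ⊤ (λ A → (t ^ ∣ A ∣) * Σ⊆ A (g ∘ (outside ∷_)))
      + t * Σ⊆ ⊤ (λ A → (t ^ ∣ A ∣) * Σ⊆ A (g ∘ (inside ∷_)))
Σ⊆-supersets-suc t g = begin
    Σ⊆ ⊤ (λ A → (t ^ ∣ A ∣) * Σ⊆ A g)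
  ≡⟨ Σ⊆-⊤-suc _ (λ A → cong ((t ^ ∣ A ∣) *_) (Σ⊆-outside A g)) inside-step ⟩
    Σ⊆ ⊤ F₀ + Σ⊆ ⊤ (λ A → t * F₀ A + t * F₁ A)
  ≡⟨ cong (Σ⊆ ⊤ F₀ +_) (Σ⊆-linear ⊤ t t F₀ F₁) ⟩
    Σ⊆ ⊤ F₀ + (t * Σ⊆ ⊤ F₀ + t * Σ⊆ ⊤ F₁)
  ≡⟨ solve 3 (λ t u v → u :+ (t :* u :+ t :* v) := (con 1ℚ :+ t) :* u :+ t :* v) refl t (Σ⊆ ⊤ F₀) (Σ⊆ ⊤ F₁) ⟩
    (1ℚ + t) * Σ⊆ ⊤ F₀ + t * Σ⊆ ⊤ F₁
  ∎
  where
  open ≡-Reasoning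
  F₀ F₁ : Subset _ → ℚ
  F₀ A = (t ^ ∣ A ∣) * Σ⊆ A (g ∘ (outside ∷_))
  F₁ A = (t ^ ∣ A ∣) * Σ⊆ A (g ∘ (inside ∷_))
  inside-step : ∀ A → (t * t ^ ∣ A ∣) * Σ⊆ (inside ∷ A) g ≡ t * F₀ A + t * F₁ A
  inside-step A = trans (cong ((t * t ^ ∣ A ∣) *_) (Σ⊆-inside A g))
    (solve 4 (λ t w u v → (t :* w) :* (u :+ v) := t :* (w :* u) :+ t :* (w :* v))
           refl t (t ^ ∣ A ∣) (Σ⊆ A (g ∘ (outside ∷_))) (Σ⊆ A (g ∘ (inside ∷_))))

-- Coordinatewise, a point of X contributes t, and a point outside X contributes t or 1
-- according as it lies in A or not.
Σ⊆-supersets : ∀ n t (g : Subset n → ℚ) →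
               Σ⊆ ⊤ (λ A → (t ^ ∣ A ∣) * Σ⊆ A g) ≡ binomialSum t (1ℚ + t) g
Σ⊆-supersets zero    t g = solve 1 (λ u → con 1ℚ :* (u :+ con 0ℚ) :+ con 0ℚ := u :* (con 1ℚ :* con 1ℚ) :+ con 0ℚ) refl (g [])
Σ⊆-supersets (suc n) t g = trans (Σ⊆-supersets-suc t g)
  (trans (cong₂ (λ u v → (1ℚ + t) * u + t * v) (Σ⊆-supersets n t (g ∘ (outside ∷_))) (Σ⊆-supersets n t (g ∘ (inside ∷_))))
         (sym (binomialSum-suc t (1ℚ + t) g)))

Σ⊆-disjoint-suc : ∀ {n} a b c (h : Subset (suc n) → ℚ) →
  Σ⊆ ⊤ (λ A → binomialWeight a b A * Σ⊆ (∁ A) (λ X → (c ^ ∣ X ∣) * h (X ∪ A)))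
    ≡ b * Σ⊆ ⊤ (λ A → binomialWeight a b A * Σ⊆ (∁ A) (λ X → (c ^ ∣ X ∣) * h (outside ∷ (X ∪ A))))
      + (a + b * c) * Σ⊆ ⊤ (λ A → binomialWeight a b A * Σ⊆ (∁ A) (λ X → (c ^ ∣ X ∣) * h (inside ∷ (X ∪ A))))
Σ⊆-disjoint-suc a b c h = begin
    Σ⊆ ⊤ (λ A → binomialWeight a b A * Σ⊆ (∁ A) (λ X → (c ^ ∣ X ∣) * h (X ∪ A)))
  ≡⟨ Σ⊆-⊤-suc _ outside-step inside-step ⟩
    Σ⊆ ⊤ (λ A → b * K₀ A + (b * c) * K₁ A) + Σ⊆ ⊤ (λ A → a * K₁ A)
  ≡⟨ cong₂ _+_ (Σ⊆-linear ⊤ b (b * c) K₀ K₁) (sym (*-distribˡ-Σ⊆ ⊤ a K₁)) ⟩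
    (b * Σ⊆ ⊤ K₀ + (b * c) * Σ⊆ ⊤ K₁) + a * Σ⊆ ⊤ K₁
  ≡⟨ solve 5 (λ a b c u v → (b :* u :+ (b :* c) :* v) :+ a :* v := b :* u :+ (a :+ b :* c) :* v)
           refl a b c (Σ⊆ ⊤ K₀) (Σ⊆ ⊤ K₁) ⟩
    b * Σ⊆ ⊤ K₀ + (a + b * c) * Σ⊆ ⊤ K₁
  ∎
  where
  open ≡-Reasoning
  I₀ I₁ K₀ K₁ : Subset _ → ℚ
  I₀ A = Σ⊆ (∁ A) (λ X → (c ^ ∣ X ∣) * h (outside ∷ (X ∪ A)))
  I₁ A = Σ⊆ (∁ A) (λ X → (c ^ ∣ X ∣) * h (inside ∷ (X ∪ A)))
  K₀ A = binomialWeight a b A * I₀ A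
  K₁ A = binomialWeight a b A * I₁ A
  outside-step : ∀ A → binomialWeight a b (outside ∷ A) * Σ⊆ (inside ∷ ∁ A) (λ X → (c ^ ∣ X ∣) * h (X ∪ (outside ∷ A)))
                       ≡ b * K₀ A + (b * c) * K₁ A
  outside-step A = begin
      binomialWeight a b (outside ∷ A) * Σ⊆ (inside ∷ ∁ A) (λ X → (c ^ ∣ X ∣) * h (X ∪ (outside ∷ A)))
    ≡⟨ cong₂ _*_ (binomialWeight-outside a b A) (Σ⊆-inside (∁ A) _) ⟩
      (b * binomialWeight a b A) * (I₀ A + Σ⊆ (∁ A) (λ X → (c * c ^ ∣ X ∣) * h (inside ∷ (X ∪ A))))
    ≡⟨ cong (λ s → (b * binomialWeight a b A) * (I₀ A + s))
            (trans (Σ⊆-cong′ (∁ A) (λ X → *-assoc c _ _)) (sym (*-distribˡ-Σ⊆ (∁ A) c _))) ⟩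
      (b * binomialWeight a b A) * (I₀ A + c * I₁ A)
    ≡⟨ solve 5 (λ b c w u v → (b :* w) :* (u :+ c :* v) := b :* (w :* u) :+ (b :* c) :* (w :* v))
             refl b c (binomialWeight a b A) (I₀ A) (I₁ A) ⟩
      b * K₀ A + (b * c) * K₁ A
    ∎
  inside-step : ∀ A → binomialWeight a b (inside ∷ A) * Σ⊆ (outside ∷ ∁ A) (λ X → (c ^ ∣ X ∣) * h (X ∪ (inside ∷ A)))
                      ≡ a * K₁ A
  inside-step A = trans (cong₂ _*_ (binomialWeight-inside a b A) (Σ⊆-outside (∁ A) _)) (*-assoc a (binomialWeight a b A) (I₁ A))

-- Coordinatewise, a point of A contributes a, a point of X contributes b c and any other point b;
-- grouping the pairs by B = X ∪ A turns this into (a + b c)^{|B|} b^{n - |B|}.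
Σ⊆-disjoint : ∀ n a b c (h : Subset n → ℚ) →
  Σ⊆ ⊤ (λ A → binomialWeight a b A * Σ⊆ (∁ A) (λ X → (c ^ ∣ X ∣) * h (X ∪ A))) ≡ binomialSum (a + b * c) b h
Σ⊆-disjoint zero    a b c h =
  solve 1 (λ u → (con 1ℚ :* con 1ℚ) :* (con 1ℚ :* u :+ con 0ℚ) :+ con 0ℚ := u :* (con 1ℚ :* con 1ℚ) :+ con 0ℚ) refl (h [])
Σ⊆-disjoint (suc n) a b c h = trans (Σ⊆-disjoint-suc a b c h)
  (trans (cong₂ (λ u v → b * u + (a + b * c) * v) (Σ⊆-disjoint n a b c (h ∘ (outside ∷_))) (Σ⊆-disjoint n a b c (h ∘ (inside ∷_))))
         (sym (binomialSum-suc (a + b * c) b h)))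

nullity : ∀ {n} → Matroid n → Subset n → ℕ
nullity M X = ∣ X ∣ ∸ rank M X

nullityPolynomial : ∀ {n} → Matroid n → ℚ → ℚ
nullityPolynomial {n} M q = Σ⊆ ⊤ (λ X → (-1ℚ ^ (n ∸ ∣ X ∣)) * (q ^ nullity M X))

module _ {n : ℕ} (M : Matroid n) where

  rank-∁⊤ : rank M (∁ ⊤) ≡ 0
  rank-∁⊤ = ℕ.n≤0⇒n≡0 (subst (rank M (∁ ⊤) ≤ℕ_) ∣∁⊤∣≡0 (rank-card M (∁ ⊤)))
    where
    ∣∁⊤∣≡0 : ∣ ∁ (⊤ {n}) ∣ ≡ 0
    ∣∁⊤∣≡0 = trans (∣∁p∣≡n∸∣p∣ (⊤ {n})) (trans (cong (n ∸_) (∣⊤∣≡n n)) (ℕ.n∸n≡0 n))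

  rank-⊤≤rank+∣∁∣ : ∀ X → rank M ⊤ ≤ℕ rank M X +ℕ ∣ ∁ X ∣
  rank-⊤≤rank+∣∁∣ X = begin
      rank M ⊤                                  ≡⟨ cong (rank M) (p∪∁p≡⊤ X) ⟨
      rank M (X ∪ ∁ X)                          ≤⟨ ℕ.m≤m+n _ _ ⟩
      rank M (X ∪ ∁ X) +ℕ rank M (X ∩ ∁ X)     ≤⟨ rank-submod M X (∁ X) ⟩
      rank M X +ℕ rank M (∁ X)                  ≤⟨ ℕ.+-monoʳ-≤ (rank M X) (rank-card M (∁ X)) ⟩
      rank M X +ℕ ∣ ∁ X ∣                       ∎
    where open ℕ.≤-Reasoning

  dualRank-⊤∸dualRank-∁ : ∀ X → dualRank M ⊤ ∸ dualRank M (∁ X) ≡ nullity M X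
  dualRank-⊤∸dualRank-∁ X = begin
      ((∣ ⊤ {n} ∣ +ℕ rank M (∁ ⊤)) ∸ R) ∸ ((∣ ∁ X ∣ +ℕ rank M (∁ (∁ X))) ∸ R)
    ≡⟨ cong₂ (λ u v → ((u +ℕ v) ∸ R) ∸ ((∣ ∁ X ∣ +ℕ rank M (∁ (∁ X))) ∸ R)) (∣⊤∣≡n n) rank-∁⊤ ⟩
      ((n +ℕ 0) ∸ R) ∸ ((∣ ∁ X ∣ +ℕ rank M (∁ (∁ X))) ∸ R)
    ≡⟨ cong₂ (λ u v → (u ∸ R) ∸ (v ∸ R)) (ℕ.+-identityʳ n) (trans (cong (∣ ∁ X ∣ +ℕ_) (cong (rank M) (∁-involutive X))) (ℕ.+-comm _ r)) ⟩
      (n ∸ R) ∸ ((r +ℕ ∣ ∁ X ∣) ∸ R)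
    ≡⟨ [m∸o]∸[n∸o]≡m∸n n (rank-⊤≤rank+∣∁∣ X) ⟩
      n ∸ (r +ℕ ∣ ∁ X ∣)
    ≡⟨ cong (λ m → n ∸ (r +ℕ m)) (∣∁p∣≡n∸∣p∣ X) ⟩
      n ∸ (r +ℕ (n ∸ k))
    ≡⟨ trans (cong (n ∸_) (ℕ.+-comm r (n ∸ k))) (sym (ℕ.∸-+-assoc n (n ∸ k) r)) ⟩
      (n ∸ (n ∸ k)) ∸ r
    ≡⟨ cong (_∸ r) (ℕ.m∸[m∸n]≡n (∣p∣≤n X)) ⟩
      k ∸ r
    ∎
    where
    open ≡-Reasoning
    R = rank M ⊤
    k = ∣ X ∣
    r = rank M X

  χDual≡nullityPolynomial : ∀ q → χDual M q ≡ nullityPolynomial M q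
  χDual≡nullityPolynomial q = trans (sym (Σ⊆-⊤-∁ n term))
    (Σ⊆-cong′ ⊤ (λ X → cong₂ (λ a b → (-1ℚ ^ a) * (q ^ b)) (∣∁p∣≡n∸∣p∣ X) (dualRank-⊤∸dualRank-∁ X)))
    where
    term : Subset n → ℚ
    term Y = (-1ℚ ^ ∣ Y ∣) * (q ^ (dualRank M ⊤ ∸ dualRank M Y))

  module _ {x y : ℚ} (x*y≡1 : x * y ≡ 1ℚ) where

    χRestr-*-^rank : ∀ A → χRestr M A x * (y ^ rank M A) ≡ Σ⊆ A (λ X → (-1ℚ ^ ∣ X ∣) * (y ^ rank M X))
    χRestr-*-^rank A = trans (*-comm (χRestr M A x) _) (trans (*-distribˡ-Σ⊆ A (y ^ rank M A) _)
      (Σ⊆-cong A (λ X X⊆A → trans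
        (solve 3 (λ c s p → c :* (s :* p) := s :* (p :* c)) refl (y ^ rank M A) (-1ℚ ^ ∣ X ∣) (x ^ (rank M A ∸ rank M X)))
        (cong ((-1ℚ ^ ∣ X ∣) *_) (^-∸-inverseˡ x*y≡1 (rank-mono M X⊆A))))))

    χContr-*-^rank : ∀ A → (y ^ rank M ⊤) * χContr M A x ≡ Σ⊆ (∁ A) (λ X → (-1ℚ ^ ∣ X ∣) * (y ^ rank M (X ∪ A)))
    χContr-*-^rank A = trans (*-distribˡ-Σ⊆ (∁ A) (y ^ rank M ⊤) _)
      (Σ⊆-cong′ (∁ A) (λ X → trans
        (solve 3 (λ c s p → c :* (s :* p) := s :* (p :* c)) refl (y ^ rank M ⊤) (-1ℚ ^ ∣ X ∣) (x ^ exponent X))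
        (cong ((-1ℚ ^ ∣ X ∣) *_) (trans (cong (λ e → x ^ e * y ^ rank M ⊤) (exponent≡ X)) (^-∸-inverseˡ x*y≡1 (rank-mono M ⊆⊤))))))
      where
      exponent : Subset n → ℕ
      exponent X = (rank M (∁ A ∪ A) ∸ rank M A) ∸ (rank M (X ∪ A) ∸ rank M A)
      exponent≡ : ∀ X → exponent X ≡ rank M ⊤ ∸ rank M (X ∪ A)
      exponent≡ X = trans (cong (λ Z → (rank M Z ∸ rank M A) ∸ (rank M (X ∪ A) ∸ rank M A)) (trans (∪-comm (∁ A) A) (p∪∁p≡⊤ A)))
        ([m∸o]∸[n∸o]≡m∸n (rank M ⊤) (rank-mono M (q⊆p∪q X A)))

  restriction-expansion : ∀ {q} (q≢0 : q ≢ 0ℚ) (1-q≢0 : 1ℚ - q ≢ 0ℚ) →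
    ((q - 1ℚ) ^ n) * Σ⊆ ⊤ (λ A → ((q * inv (1ℚ - q) 1-q≢0) ^ ∣ A ∣) * (χRestr M A q * (inv q q≢0 ^ rank M A)))
      ≡ nullityPolynomial M q
  restriction-expansion {q} q≢0 1-q≢0 = begin
      (q - 1ℚ) ^ n * Σ⊆ ⊤ (λ A → (t ^ ∣ A ∣) * (χRestr M A q * (q⁻¹ ^ rank M A)))
    ≡⟨ cong ((q - 1ℚ) ^ n *_) (Σ⊆-cong′ ⊤ (λ A → cong ((t ^ ∣ A ∣) *_) (χRestr-*-^rank (*-inv≡1 q q≢0) A))) ⟩
      (q - 1ℚ) ^ n * Σ⊆ ⊤ (λ A → (t ^ ∣ A ∣) * Σ⊆ A g)
    ≡⟨ cong ((q - 1ℚ) ^ n *_) (Σ⊆-supersets n t g) ⟩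
      (q - 1ℚ) ^ n * binomialSum t (1ℚ + t) g
    ≡⟨ *-distribˡ-Σ⊆ (⊤ {n}) ((q - 1ℚ) ^ n) _ ⟩
      Σ⊆ ⊤ (λ X → (q - 1ℚ) ^ n * (g X * binomialWeight t (1ℚ + t) X))
    ≡⟨ Σ⊆-cong′ ⊤ term ⟩
      nullityPolynomial M q
    ∎
    where
    open ≡-Reasoning
    q⁻¹ = inv q q≢0
    u = inv (1ℚ - q) 1-q≢0
    t = q * u
    u*[1-q]≡1 : u * (1ℚ - q) ≡ 1ℚ
    u*[1-q]≡1 = *-inverseˡ (1ℚ - q) {{≢-nonZero 1-q≢0}}
    g : Subset n → ℚ
    g X = (-1ℚ ^ ∣ X ∣) * (q⁻¹ ^ rank M X)
    term : ∀ X → (q - 1ℚ) ^ n * (g X * binomialWeight t (1ℚ + t) X) ≡ (-1ℚ ^ (n ∸ ∣ X ∣)) * (q ^ nullity M X)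
    term X = begin
        (q - 1ℚ) ^ n * (g X * binomialWeight t (1ℚ + t) X)
      ≡⟨ solve 3 (λ z u w → z :* (u :* w) := u :* (z :* w)) refl ((q - 1ℚ) ^ n) (g X) (binomialWeight t (1ℚ + t) X) ⟩
        g X * ((q - 1ℚ) ^ n * binomialWeight t (1ℚ + t) X)
      ≡⟨ cong (g X *_) (trans (^-*-binomialWeight (q - 1ℚ) t (1ℚ + t) X)
                              (cong₂ (λ a b → binomialWeight a b X) (q*u*[q-1]≡-q q u u*[1-q]≡1) ([1+q*u]*[q-1]≡-1 q u u*[1-q]≡1))) ⟩
        ((-1ℚ ^ k) * (q⁻¹ ^ r)) * ((- q) ^ k * (-1ℚ ^ m))
      ≡⟨ solve 4 (λ s i p o → (s :* i) :* (p :* o) := o :* ((s :* p) :* i)) refl (-1ℚ ^ k) (q⁻¹ ^ r) ((- q) ^ k) (-1ℚ ^ m) ⟩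
        (-1ℚ ^ m) * (((-1ℚ ^ k) * (- q) ^ k) * (q⁻¹ ^ r))
      ≡⟨ cong (λ u → (-1ℚ ^ m) * (u * (q⁻¹ ^ r)))
              (trans (sym (^-distrib-* -1ℚ (- q) k)) (cong (_^ k) (solve 1 (λ q → con -1ℚ :* (:- q) := q) refl q))) ⟩
        (-1ℚ ^ m) * ((q ^ k) * (q⁻¹ ^ r))
      ≡⟨ cong ((-1ℚ ^ m) *_) (^-∸-inverseʳ (*-inv≡1 q q≢0) (rank-card M X)) ⟩
        (-1ℚ ^ m) * (q ^ nullity M X)
      ∎
      where
      k = ∣ X ∣
      m = n ∸ k
      r = rank M X

  contraction-expansion : ∀ {q} (q≢0 : q ≢ 0ℚ) →
    (inv q q≢0 ^ rank M ⊤) * Σ⊆ ⊤ (λ A → (-1ℚ ^ (n ∸ ∣ A ∣)) * (((q - 1ℚ) ^ ∣ A ∣) * χContr M A q))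
      ≡ nullityPolynomial M q
  contraction-expansion {q} q≢0 = begin
      (q⁻¹ ^ R) * Σ⊆ ⊤ (λ A → (-1ℚ ^ (n ∸ ∣ A ∣)) * (((q - 1ℚ) ^ ∣ A ∣) * χContr M A q))
    ≡⟨ *-distribˡ-Σ⊆ (⊤ {n}) (q⁻¹ ^ R) _ ⟩
      Σ⊆ ⊤ (λ A → (q⁻¹ ^ R) * ((-1ℚ ^ (n ∸ ∣ A ∣)) * (((q - 1ℚ) ^ ∣ A ∣) * χContr M A q)))
    ≡⟨ Σ⊆-cong′ ⊤ (λ A → trans
          (solve 4 (λ c b a x → c :* (b :* (a :* x)) := (a :* b) :* (c :* x))
                 refl (q⁻¹ ^ R) (-1ℚ ^ (n ∸ ∣ A ∣)) ((q - 1ℚ) ^ ∣ A ∣) (χContr M A q))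
          (cong (binomialWeight (q - 1ℚ) -1ℚ A *_) (χContr-*-^rank (*-inv≡1 q q≢0) A))) ⟩
      Σ⊆ ⊤ (λ A → binomialWeight (q - 1ℚ) -1ℚ A * Σ⊆ (∁ A) (λ X → (-1ℚ ^ ∣ X ∣) * h (X ∪ A)))
    ≡⟨ Σ⊆-disjoint n (q - 1ℚ) -1ℚ -1ℚ h ⟩
      binomialSum ((q - 1ℚ) + -1ℚ * -1ℚ) -1ℚ h
    ≡⟨ Σ⊆-cong′ ⊤ term ⟩
      nullityPolynomial M q
    ∎
    where
    open ≡-Reasoning
    q⁻¹ = inv q q≢0
    R = rank M ⊤
    h : Subset n → ℚ
    h B = q⁻¹ ^ rank M B
    term : ∀ B → h B * binomialWeight ((q - 1ℚ) + -1ℚ * -1ℚ) -1ℚ B ≡ (-1ℚ ^ (n ∸ ∣ B ∣)) * (q ^ nullity M B)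
    term B = begin
        h B * (((q - 1ℚ) + -1ℚ * -1ℚ) ^ ∣ B ∣ * (-1ℚ ^ (n ∸ ∣ B ∣)))
      ≡⟨ cong (λ z → h B * (z ^ ∣ B ∣ * (-1ℚ ^ (n ∸ ∣ B ∣)))) (solve 1 (λ q → (q :- con 1ℚ) :+ con -1ℚ :* con -1ℚ := q) refl q) ⟩
        h B * (q ^ ∣ B ∣ * (-1ℚ ^ (n ∸ ∣ B ∣)))
      ≡⟨ solve 3 (λ a b c → a :* (b :* c) := c :* (b :* a)) refl (h B) (q ^ ∣ B ∣) (-1ℚ ^ (n ∸ ∣ B ∣)) ⟩
        (-1ℚ ^ (n ∸ ∣ B ∣)) * (q ^ ∣ B ∣ * h B)
      ≡⟨ cong ((-1ℚ ^ (n ∸ ∣ B ∣)) *_) (^-∸-inverseʳ (*-inv≡1 q q≢0) (rank-card M B)) ⟩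
        (-1ℚ ^ (n ∸ ∣ B ∣)) * (q ^ nullity M B)
      ∎

theorem2 : (n : ℕ) (M : Matroid n) (q : ℚ) (q≢0 : q ≢ 0ℚ) (1-q≢0 : 1ℚ - q ≢ 0ℚ) →
    (χDual M q ≡ ((q - 1ℚ) ^ n) * Σ⊆ ⊤ (λ A → ((q * inv (1ℚ - q) 1-q≢0) ^ ∣ A ∣) * (χRestr M A q * (inv q q≢0 ^ rank M A))))
    × (χDual M q ≡ (inv q q≢0 ^ rank M ⊤) * Σ⊆ ⊤ (λ A → (-1ℚ ^ (n ∸ ∣ A ∣)) * (((q - 1ℚ) ^ ∣ A ∣) * χContr M A q)))
theorem2 n M q q≢0 1-q≢0 =
    trans (χDual≡nullityPolynomial M q) (sym (restriction-expansion M q≢0 1-q≢0))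
  , trans (χDual≡nullityPolynomial M q) (sym (contraction-expansion M q≢0))
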